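{- Let $n\ge 1$ and $k\ge 2$ be integers and let $f,g$ be multisets on $\mathbb{Z}_2^n$. (1) If $f$ and $g$ are $k$-indistinguishable, then for every linear map $\theta:\mathbb{Z}_2^n\to\mathbb{Z}_2^p$ (any $p\ge 0$), the multisets $\theta f$ and $\theta g$ on $\mathbb{Z}_2^p$ are $k$-indistinguishable. (2) If $f$ and $g$ are $k$-distinguishable, then there exists a linear map $\theta:\mathbb{Z}_2^n\to\mathbb{Z}_2^{k-1}$ such that $\theta f$ and $\theta g$ are $k$-distinguishable.
   Context: A multiset on $\mathbb{Z}_2^m$ is a function $\phi:\mathbb{Z}_2^m\to\mathbb{N}$ (nonnegative integers). Its $i$-deck is the function $\mathrm{deck}_i\phi:(\mathbb{Z}_2^m)^i\to\mathbb{N}$, $\mathrm{deck}_i\phi(s_1,\dots,s_i)=\sum_{g\in\mathbb{Z}_2^m}\phi(g+s_1)\phi(g+s_2)\cdots\phi(g+s_i)$. Two multisets $\phi,\psi$ on $\mathbb{Z}_2^m$ are $k$-indistinguishable if $\mathrm{deck}_i\phi=\mathrm{deck}_i\psi$ for all $i\le k$, and $k$-distinguishable otherwise. For a linear map $\theta:\mathbb{Z}_2^n\to\mathbb{Z}_2^p$ and a multiset $f$ on $\mathbb{Z}_2^n$, $\theta f$ is the multiset on $\mathbb{Z}_2^p$ given by $\theta f(x)=\sum_{z:\theta z=x}f(z)$. -}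

module Defs where

open import Data.Nat using (ℕ; zero; suc; _+_; _*_; _≤_)
open import Data.Bool using (Bool; true; false; _xor_; _∧_; if_then_else_)
open import Data.Bool.Properties using () renaming (_≟_ to _≟B_)
open import Data.Vec using (Vec; []; _∷_; zipWith; map; replicate)
open import Data.Vec.Properties using (≡-dec)
open import Data.Fin using (Fin)
open import Data.List using (List; []; _∷_; _++_) renaming (map to lmap)
open import Data.Product using (_×_; Σ)
open import Relation.Nullary using (¬_; Dec; yes; no)
open import Relation.Nullary.Decidable using (⌊_⌋)
open import Relation.Binary.PropositionalEquality using (_≡_)
open import Data.Nat.ListAction using (sum)

Z2^ : ℕ → Set
Z2^ m = Vec Bool m

infixl 6 _⊕_
_⊕_ : ∀ {m} → Z2^ m → Z2^ m → Z2^ m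
_⊕_ = zipWith _xor_

_·_ : ∀ {m} → Bool → Z2^ m → Z2^ m
c · x = map (c ∧_) x

_≟V_ : ∀ {m} (x y : Z2^ m) → Dec (x ≡ y)
_≟V_ = ≡-dec _≟B_

elems : (m : ℕ) → List (Z2^ m)
elems zero = [] ∷ []
elems (suc m) = lmap (false ∷_) (elems m) ++ lmap (true ∷_) (elems m)

Σ[g∈Z2^_] : (m : ℕ) → (Z2^ m → ℕ) → ℕ
Σ[g∈Z2^ m ] h = sum (lmap h (elems m))

Multiset : ℕ → Set
Multiset m = Z2^ m → ℕ

prodFin : (i : ℕ) → (Fin i → ℕ) → ℕ
prodFin zero h = 1
prodFin (suc i) h = h Fin.zero * prodFin i (λ j → h (Fin.suc j))

deck : ∀ {m} (i : ℕ) → Multiset m → (Fin i → Z2^ m) → ℕ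
deck {m} i φ s = Σ[g∈Z2^ m ] (λ g → prodFin i (λ j → φ (g ⊕ s j)))

Indist : ∀ {m} (k : ℕ) → Multiset m → Multiset m → Set
Indist {m} k φ ψ = ∀ i → i ≤ k → ∀ (s : Fin i → Z2^ m) → deck i φ s ≡ deck i ψ s

Dist : ∀ {m} (k : ℕ) → Multiset m → Multiset m → Set
Dist k φ ψ = ¬ Indist k φ ψ

IsLinear : ∀ {n p} → (Z2^ n → Z2^ p) → Set
IsLinear θ = (∀ x y → θ (x ⊕ y) ≡ θ x ⊕ θ y) × (∀ c x → θ (c · x) ≡ c · θ x)

push : ∀ {n p} → (Z2^ n → Z2^ p) → Multiset n → Multiset p
push {n} θ f x = Σ[g∈Z2^ n ] (λ z → if ⌊ θ z ≟V x ⌋ then f z else 0)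

-- For an additive c : Z₂ᵐ → Z₂ write φ̂(c) = Σₓ φ(x)(−1)^{c(x)}. Since the i-deck is a sum of
-- translates, its Fourier transform at (c₁,…,cᵢ) factors as (Σₓ ∏ⱼ (−1)^{cⱼ(x)}) · ∏ⱼ φ̂(cⱼ), and the
-- first factor is 2ᵐ if c₁ + ⋯ + cᵢ = 0 and vanishes for characters cⱼ = χⱼ·_ with χ₁ + ⋯ + χᵢ ≠ 0.
-- By Fourier inversion on i-tuples, φ and ψ are k-indistinguishable iff ∏ⱼ φ̂(χⱼ·_) = ∏ⱼ ψ̂(χⱼ·_) for
-- all zero-sum tuples (χ₁,…,χᵢ) with i ≤ k. Part (1) follows from (θφ)^(c) = φ̂(c ∘ θ). For part (2),
-- exhaustive search yields a zero-sum tuple (χ₀,…,χᵢ), i < k, on which the products differ; then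
-- θ z = (χ₁·z,…,χᵢ·z,0,…,0) ∈ Z₂^{k−1} works, because the zero-sum family of characters
-- y₁ + ⋯ + yᵢ, y₁, …, yᵢ of Z₂^{k−1} pulls back along θ to χ₀, χ₁, …, χᵢ.

module Submission where

open import Defs
open import Data.Nat using (ℕ; _≤_; _∸_)
open import Data.Product using (_×_; Σ)

open import Algebra using (CommutativeRing)
open import Data.Bool using (Bool; true; false; _xor_; _∧_; if_then_else_)
open import Data.Bool.Properties
  using (xor-same; xor-assoc; xor-identityʳ; ∧-comm; ∧-zeroʳ; ∧-distribˡ-xor; ∧-distribʳ-xor;
         xor-∧-commutativeRing)
open import Data.Empty using (⊥-elim)
open import Data.Fin using (Fin; zero; suc)
open import Data.Integer using (ℤ; +_; 0ℤ; 1ℤ; -1ℤ; _+_; _*_; NonZero)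
import Data.Integer.Properties as ℤ
open import Data.Integer.Tactic.RingSolver using (solve-∀)
open import Data.List using (_++_) renaming (map to mapL)
import Data.List.Properties as List
import Data.Nat.ListAction.Properties as ListSum
open import Data.Nat.ListAction using (sum)
open import Data.Nat as ℕ using (zero; suc; z≤n; s≤s)
import Data.Nat.Properties as ℕ
open import Data.Product using (_,_; ∃; ∃-syntax)
open import Data.Sum using (_⊎_; inj₁; inj₂)
open import Data.Vec using (Vec; []; _∷_; lookup; map; replicate; tabulate; truncate; padRight)
open import Data.Vec.Properties
  using (lookup-map; lookup-zipWith; lookup∘tabulate; map-replicate; zipWith-replicate; truncate-padRight)
open import Function using (_∘_)
open import Relation.Binary.PropositionalEquality
open import Relation.Nullary using (Dec; does; yes; no; _because_)
open import Relation.Nullary.Decidable using (⌊_⌋; dec-false)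

open import Algebra.Properties.CommutativeSemigroup ℤ.+-commutativeSemigroup
  using () renaming (interchange to +-interchange)
open import Algebra.Properties.CommutativeSemigroup ℤ.*-commutativeSemigroup
  using (x∙yz≈y∙xz; x∙yz≈y∙zx; xy∙z≈x∙zy) renaming (interchange to *-interchange)
open import Algebra.Properties.CommutativeSemigroup
  (CommutativeRing.+-commutativeSemigroup xor-∧-commutativeRing)
  using () renaming (interchange to xor-interchange)
open import Algebra.Properties.CommutativeMonoid.Sum ℤ.*-1-commutativeMonoid
  using () renaming (sum to ∏; sum-cong-≗ to ∏-cong; ∑-distrib-+ to ∏-distrib-*)
open import Algebra.Properties.CommutativeMonoid.Sum
  (CommutativeRing.+-commutativeMonoid xor-∧-commutativeRing)
  using () renaming (sum to ⨁; sum-cong-≗ to ⨁-cong; ∑-distrib-+ to ⨁-distrib-xor)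

zeros : ∀ m → Z2^ m
zeros m = replicate m false

⊕-zerosʳ : ∀ {m} (x : Z2^ m) → x ⊕ zeros m ≡ x
⊕-zerosʳ [] = refl
⊕-zerosʳ (a ∷ x) = cong₂ _∷_ (xor-identityʳ a) (⊕-zerosʳ x)

⊕-cancelˡ : ∀ {m} (x y : Z2^ m) → x ⊕ (x ⊕ y) ≡ y
⊕-cancelˡ [] [] = refl
⊕-cancelˡ (a ∷ x) (b ∷ y) =
  cong₂ _∷_ (trans (sym (xor-assoc a a b)) (cong (_xor b) (xor-same a))) (⊕-cancelˡ x y)

⊕≡zeros⇒≡ : ∀ {m} {x y : Z2^ m} → x ⊕ y ≡ zeros m → x ≡ y
⊕≡zeros⇒≡ {m} {x} {y} x⊕y≡0 = begin
  x                ≡⟨ sym (⊕-zerosʳ x) ⟩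
  x ⊕ zeros m      ≡⟨ cong (x ⊕_) (sym x⊕y≡0) ⟩
  x ⊕ (x ⊕ y)      ≡⟨ ⊕-cancelˡ x y ⟩
  y                ∎
  where open ≡-Reasoning

vsum : ∀ {m i} → Vec (Z2^ m) i → Z2^ m
vsum {m} [] = zeros m
vsum (a ∷ χ) = a ⊕ vsum χ

dot : ∀ {m} → Z2^ m → Z2^ m → Bool
dot [] [] = false
dot (a ∷ x) (b ∷ y) = (a ∧ b) xor dot x y

dot-comm : ∀ {m} (x y : Z2^ m) → dot x y ≡ dot y x
dot-comm [] [] = refl
dot-comm (a ∷ x) (b ∷ y) = cong₂ _xor_ (∧-comm a b) (dot-comm x y)

dot-zerosˡ : ∀ {m} (x : Z2^ m) → dot (zeros m) x ≡ false
dot-zerosˡ [] = refl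
dot-zerosˡ (_ ∷ x) = dot-zerosˡ x

dot-zerosʳ : ∀ {m} (x : Z2^ m) → dot x (zeros m) ≡ false
dot-zerosʳ [] = refl
dot-zerosʳ (a ∷ x) = cong₂ _xor_ (∧-zeroʳ a) (dot-zerosʳ x)

dot-⊕ˡ : ∀ {m} (x y a : Z2^ m) → dot (x ⊕ y) a ≡ dot x a xor dot y a
dot-⊕ˡ [] [] [] = refl
dot-⊕ˡ (x ∷ xs) (y ∷ ys) (a ∷ as) =
  trans (cong₂ _xor_ (∧-distribʳ-xor a x y) (dot-⊕ˡ xs ys as))
    (xor-interchange (x ∧ a) (y ∧ a) (dot xs as) (dot ys as))

dot-⊕ʳ : ∀ {m} (a x y : Z2^ m) → dot a (x ⊕ y) ≡ dot a x xor dot a y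
dot-⊕ʳ [] [] [] = refl
dot-⊕ʳ (a ∷ as) (x ∷ xs) (y ∷ ys) =
  trans (cong₂ _xor_ (∧-distribˡ-xor a x y) (dot-⊕ʳ as xs ys))
    (xor-interchange (a ∧ x) (a ∧ y) (dot as xs) (dot as ys))

dot-·ʳ : ∀ {m} (a : Z2^ m) c x → dot a (c · x) ≡ c ∧ dot a x
dot-·ʳ [] c [] = sym (∧-zeroʳ c)
dot-·ʳ (a ∷ as) false (x ∷ xs) = cong₂ _xor_ (∧-zeroʳ a) (dot-·ʳ as false xs)
dot-·ʳ (a ∷ as) true (x ∷ xs) = cong ((a ∧ x) xor_) (dot-·ʳ as true xs)

⨁-dot : ∀ {m i} (χ : Vec (Z2^ m) i) x → ⨁ (λ j → dot (lookup χ j) x) ≡ dot (vsum χ) x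
⨁-dot [] x = sym (dot-zerosˡ x)
⨁-dot (a ∷ χ) x = trans (cong (dot a x xor_) (⨁-dot χ x)) (sym (dot-⊕ˡ a (vsum χ) x))

-- Via `does` rather than `⌊_⌋`, so that δ (a ∷ x) (b ∷ y) computes on known heads a and b.
δ : ∀ {m} → Z2^ m → Z2^ m → ℤ
δ a x = if does (a ≟V x) then 1ℤ else 0ℤ

δ-≢ : ∀ {m} {a x : Z2^ m} → a ≢ x → δ a x ≡ 0ℤ
δ-≢ {a = a} {x} a≢x = cong (if_then 1ℤ else 0ℤ) (dec-false (a ≟V x) a≢x)

Summation : Set → Set
Summation A = (A → ℤ) → ℤ

record IsSum {A : Set} (∑ : Summation A) : Set where
  field
    ∑-cong       : ∀ {h h′} → h ≗ h′ → ∑ h ≡ ∑ h′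
    ∑-distrib-+  : ∀ h h′ → ∑ (λ x → h x + h′ x) ≡ ∑ h + ∑ h′
    ∑-distribˡ-* : ∀ c h → ∑ (λ x → c * h x) ≡ c * ∑ h

  ∑-distribʳ-* : ∀ c h → ∑ (λ x → h x * c) ≡ ∑ h * c
  ∑-distribʳ-* c h =
    trans (∑-cong (λ x → ℤ.*-comm (h x) c)) (trans (∑-distribˡ-* c h) (ℤ.*-comm c (∑ h)))

Fubini : {A : Set} → Summation A → Set₁
Fubini {A} ∑A = ∀ {B : Set} {∑B : Summation B} → IsSum ∑B →
  (h : A → B → ℤ) → ∑A (λ a → ∑B (h a)) ≡ ∑B (λ b → ∑A (λ a → h a b))

∑Bool : Summation Bool
∑Bool h = h false + h true

∑Bool-isSum : IsSum ∑Bool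
∑Bool-isSum = record
  { ∑-cong       = λ h≗h′ → cong₂ _+_ (h≗h′ false) (h≗h′ true)
  ; ∑-distrib-+  = λ h h′ → +-interchange (h false) (h′ false) (h true) (h′ true)
  ; ∑-distribˡ-* = λ c h → sym (ℤ.*-distribˡ-+ c (h false) (h true))
  }

∑Bool-fubini : Fubini ∑Bool
∑Bool-fubini ∑B-isSum h = sym (IsSum.∑-distrib-+ ∑B-isSum (h false) (h true))

∑Vec : {A : Set} → Summation A → ∀ n → Summation (Vec A n)
∑Vec ∑A zero h = h []
∑Vec ∑A (suc n) h = ∑A (λ a → ∑Vec ∑A n (λ v → h (a ∷ v)))

module _ {A : Set} {∑A : Summation A} (∑A-isSum : IsSum ∑A) where
  private module ∑A = IsSum ∑A-isSum

  ∑Vec-isSum : ∀ n → IsSum (∑Vec ∑A n)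
  ∑Vec-isSum zero = record
    { ∑-cong = λ h≗h′ → h≗h′ [] ; ∑-distrib-+ = λ _ _ → refl ; ∑-distribˡ-* = λ _ _ → refl }
  ∑Vec-isSum (suc n) = record
    { ∑-cong       = λ h≗h′ → ∑A.∑-cong (λ a → IH.∑-cong (λ v → h≗h′ (a ∷ v)))
    ; ∑-distrib-+  = λ h h′ → trans (∑A.∑-cong (λ a → IH.∑-distrib-+ _ _)) (∑A.∑-distrib-+ _ _)
    ; ∑-distribˡ-* = λ c h → trans (∑A.∑-cong (λ a → IH.∑-distribˡ-* c _)) (∑A.∑-distribˡ-* c _)
    }
    where module IH = IsSum (∑Vec-isSum n)

  ∑Vec-fubini : Fubini ∑A → ∀ n → Fubini (∑Vec ∑A n)
  ∑Vec-fubini fubini zero ∑B-isSum h = refl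
  ∑Vec-fubini fubini (suc n) ∑B-isSum h =
    trans (∑A.∑-cong (λ a → ∑Vec-fubini fubini n ∑B-isSum (λ v → h (a ∷ v))))
          (fubini ∑B-isSum (λ a b → ∑Vec ∑A n (λ v → h (a ∷ v) b)))

  ∑Vec-∏ : ∀ n (F : Fin n → A → ℤ) → ∑Vec ∑A n (λ v → ∏ (λ j → F j (lookup v j))) ≡ ∏ (λ j → ∑A (F j))
  ∑Vec-∏ zero F = refl
  ∑Vec-∏ (suc n) F = trans
    (∑A.∑-cong (λ a → trans (IsSum.∑-distribˡ-* (∑Vec-isSum n) (F zero a) _)
                           (cong (F zero a *_) (∑Vec-∏ n (F ∘ suc)))))
    (∑A.∑-distribʳ-* _ (F zero))

  ∑Vec-δ : (δA : A → A → ℤ) → (∀ a h → ∑A (λ x → δA a x * h x) ≡ h a) →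
    ∀ n (s : Vec A n) h → ∑Vec ∑A n (λ t → ∏ (λ j → δA (lookup s j) (lookup t j)) * h t) ≡ h s
  ∑Vec-δ δA ∑A-δ zero [] h = ℤ.*-identityˡ (h [])
  ∑Vec-δ δA ∑A-δ (suc n) (a ∷ s) h = begin
    ∑A (λ x → ∑Vec ∑A n (λ t → δA a x * ∏ (λ j → δA (lookup s j) (lookup t j)) * h (x ∷ t)))
      ≡⟨ ∑A.∑-cong (λ x → trans (IH.∑-cong (λ t → ℤ.*-assoc (δA a x) _ _)) (IH.∑-distribˡ-* (δA a x) _)) ⟩
    ∑A (λ x → δA a x * ∑Vec ∑A n (λ t → ∏ (λ j → δA (lookup s j) (lookup t j)) * h (x ∷ t)))
      ≡⟨ ∑A.∑-cong (λ x → cong (δA a x *_) (∑Vec-δ δA ∑A-δ n s (λ t → h (x ∷ t)))) ⟩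
    ∑A (λ x → δA a x * h (x ∷ s))
      ≡⟨ ∑A-δ a (λ x → h (x ∷ s)) ⟩
    h (a ∷ s) ∎
    where
    open ≡-Reasoning
    module IH = IsSum (∑Vec-isSum n)

∑Z2^ : ∀ m → Summation (Z2^ m)
∑Z2^ = ∑Vec ∑Bool

∑Z2^-isSum : ∀ m → IsSum (∑Z2^ m)
∑Z2^-isSum = ∑Vec-isSum ∑Bool-isSum

module ∑Z2^ (m : ℕ) = IsSum (∑Z2^-isSum m)

∑Z2^-fubini : ∀ m → Fubini (∑Z2^ m)
∑Z2^-fubini = ∑Vec-fubini ∑Bool-isSum ∑Bool-fubini

∑Z2^-translate : ∀ m (g : Z2^ m) h → ∑Z2^ m (λ y → h (g ⊕ y)) ≡ ∑Z2^ m h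
∑Z2^-translate zero [] h = refl
∑Z2^-translate (suc m) (false ∷ g) h =
  cong₂ _+_ (∑Z2^-translate m g (λ y → h (false ∷ y))) (∑Z2^-translate m g (λ y → h (true ∷ y)))
∑Z2^-translate (suc m) (true ∷ g) h = trans
  (cong₂ _+_ (∑Z2^-translate m g (λ y → h (true ∷ y))) (∑Z2^-translate m g (λ y → h (false ∷ y))))
  (ℤ.+-comm (∑Z2^ m (λ y → h (true ∷ y))) (∑Z2^ m (λ y → h (false ∷ y))))

∑Z2^-δ : ∀ m (a : Z2^ m) h → ∑Z2^ m (λ x → δ a x * h x) ≡ h a
∑Z2^-δ zero [] h = ℤ.*-identityˡ (h [])
∑Z2^-δ (suc m) (false ∷ a) h = trans
  (cong₂ _+_ (∑Z2^-δ m a (λ x → h (false ∷ x))) (∑Z2^.∑-distribˡ-* m 0ℤ (λ x → h (true ∷ x))))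
  (ℤ.+-identityʳ _)
∑Z2^-δ (suc m) (true ∷ a) h = trans
  (cong₂ _+_ (∑Z2^.∑-distribˡ-* m 0ℤ (λ x → h (false ∷ x))) (∑Z2^-δ m a (λ x → h (true ∷ x))))
  (ℤ.+-identityˡ _)

∑Tuples : ∀ m i → Summation (Vec (Z2^ m) i)
∑Tuples m = ∑Vec (∑Z2^ m)

∑Tuples-isSum : ∀ m i → IsSum (∑Tuples m i)
∑Tuples-isSum m = ∑Vec-isSum (∑Z2^-isSum m)

module ∑Tuples (m i : ℕ) = IsSum (∑Tuples-isSum m i)

∑Tuples-fubini : ∀ m i → Fubini (∑Tuples m i)
∑Tuples-fubini m = ∑Vec-fubini (∑Z2^-isSum m) (∑Z2^-fubini m)

card : ℕ → ℤ
card m = ∑Z2^ m (λ _ → 1ℤ)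

card≡2^ : ∀ m → card m ≡ + (2 ℕ.^ m)
card≡2^ zero = refl
card≡2^ (suc m) = begin
  card m + card m                 ≡⟨ cong₂ _+_ (card≡2^ m) (card≡2^ m) ⟩
  + (2 ℕ.^ m) + + (2 ℕ.^ m)       ≡⟨ sym (ℤ.pos-+ (2 ℕ.^ m) (2 ℕ.^ m)) ⟩
  + (2 ℕ.^ m ℕ.+ 2 ℕ.^ m)         ≡⟨ cong (λ n → + (2 ℕ.^ m ℕ.+ n)) (sym (ℕ.+-identityʳ (2 ℕ.^ m))) ⟩
  + (2 ℕ.^ suc m)                 ∎
  where open ≡-Reasoning

card-nonZero : ∀ m → NonZero (card m)
card-nonZero m = subst NonZero (sym (card≡2^ m)) (ℕ.m^n≢0 2 m)

card^ : ℕ → ℕ → ℤ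
card^ m i = ∏ {i} (λ _ → card m)

card^-nonZero : ∀ m i → NonZero (card^ m i)
card^-nonZero m zero = _
card^-nonZero m (suc i) = ℤ.i*j≢0 (card m) _ {{card-nonZero m}} {{card^-nonZero m i}}

sign : Bool → ℤ
sign false = 1ℤ
sign true = -1ℤ

sign-xor : ∀ a b → sign (a xor b) ≡ sign a * sign b
sign-xor false false = refl
sign-xor false true = refl
sign-xor true false = refl
sign-xor true true = refl

∏-sign : ∀ {i} (b : Fin i → Bool) → ∏ (sign ∘ b) ≡ sign (⨁ b)
∏-sign {zero} b = refl
∏-sign {suc i} b = trans (cong (sign (b zero) *_) (∏-sign (b ∘ suc))) (sym (sign-xor (b zero) (⨁ (b ∘ suc))))

∑Z2^-sign-dot : ∀ m (x y : Z2^ m) → ∑Z2^ m (λ a → sign (dot a x) * sign (dot a y)) ≡ card m * δ x y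
∑Z2^-sign-dot zero [] [] = refl
∑Z2^-sign-dot (suc m) (b ∷ x) (c ∷ y) = begin
  S + ∑Z2^ m (λ a → sign (b xor dot a x) * sign (c xor dot a y))
    ≡⟨ cong (λ z → S + z) (trans (∑Z2^.∑-cong m split) (∑Z2^.∑-distribˡ-* m (sign b * sign c) _)) ⟩
  S + sign b * sign c * S
    ≡⟨ cong (λ z → z + sign b * sign c * z) (∑Z2^-sign-dot m x y) ⟩
  card m * δ x y + sign b * sign c * (card m * δ x y)
    ≡⟨ combine b c ⟩
  (card m + card m) * δ (b ∷ x) (c ∷ y) ∎
  where
  open ≡-Reasoning
  S : ℤ
  S = ∑Z2^ m (λ a → sign (dot a x) * sign (dot a y))
  split : ∀ a → sign (b xor dot a x) * sign (c xor dot a y)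
              ≡ sign b * sign c * (sign (dot a x) * sign (dot a y))
  split a = trans (cong₂ _*_ (sign-xor b (dot a x)) (sign-xor c (dot a y)))
                  (*-interchange (sign b) (sign (dot a x)) (sign c) (sign (dot a y)))
  equal : ∀ M d → M * d + 1ℤ * (M * d) ≡ (M + M) * d
  equal = solve-∀
  opposite : ∀ M d → M * d + -1ℤ * (M * d) ≡ (M + M) * 0ℤ
  opposite = solve-∀
  combine : ∀ b c → card m * δ x y + sign b * sign c * (card m * δ x y)
                  ≡ (card m + card m) * δ (b ∷ x) (c ∷ y)
  combine false false = equal (card m) (δ x y)
  combine false true = opposite (card m) (δ x y)
  combine true false = opposite (card m) (δ x y)
  combine true true = equal (card m) (δ x y)

IsAdditive : ∀ {m} → (Z2^ m → Bool) → Set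
IsAdditive c = ∀ x y → c (x ⊕ y) ≡ c x xor c y

Balanced : ∀ {m i} → (Fin i → Z2^ m → Bool) → Set
Balanced c = ∀ x → ⨁ (λ j → c j x) ≡ false

characterSum : ∀ m {i} → (Fin i → Z2^ m → Bool) → ℤ
characterSum m c = ∑Z2^ m (λ x → ∏ (λ j → sign (c j x)))

characterSum-balanced : ∀ {m i} (c : Fin i → Z2^ m → Bool) → Balanced c → characterSum m c ≡ card m
characterSum-balanced {m} c balanced =
  ∑Z2^.∑-cong m (λ x → trans (∏-sign (λ j → c j x)) (cong sign (balanced x)))

characterSum-dots : ∀ {m i} (χ : Vec (Z2^ m) i) → vsum χ ≢ zeros m → characterSum m (dot ∘ lookup χ) ≡ 0ℤ
characterSum-dots {m} χ χ≢0 = begin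
  ∑Z2^ m (λ x → ∏ (λ j → sign (dot (lookup χ j) x)))
    ≡⟨ ∑Z2^.∑-cong m (λ x → trans (∏-sign (λ j → dot (lookup χ j) x)) (cong sign (⨁-dot χ x))) ⟩
  ∑Z2^ m (λ x → sign (dot (vsum χ) x))
    ≡⟨ ∑Z2^.∑-cong m (λ x → trans (cong sign (dot-comm (vsum χ) x))
         (sym (trans (cong (λ b → sign (dot x (vsum χ)) * sign b) (dot-zerosʳ x)) (ℤ.*-identityʳ _)))) ⟩
  ∑Z2^ m (λ x → sign (dot x (vsum χ)) * sign (dot x (zeros m)))
    ≡⟨ ∑Z2^-sign-dot m (vsum χ) (zeros m) ⟩
  card m * δ (vsum χ) (zeros m)
    ≡⟨ cong (card m *_) (δ-≢ χ≢0) ⟩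
  card m * 0ℤ
    ≡⟨ ℤ.*-zeroʳ (card m) ⟩
  0ℤ ∎
  where open ≡-Reasoning

+-Σ : ∀ m (h : Z2^ m → ℕ) → + (Σ[g∈Z2^ m ] h) ≡ ∑Z2^ m (+_ ∘ h)
+-Σ zero h = cong +_ (ℕ.+-identityʳ (h []))
+-Σ (suc m) h = begin
  + sum (mapL h (mapL (false ∷_) (elems m) ++ mapL (true ∷_) (elems m)))
    ≡⟨ cong (+_ ∘ sum) (List.map-++ h (mapL (false ∷_) (elems m)) _) ⟩
  + sum (mapL h (mapL (false ∷_) (elems m)) ++ mapL h (mapL (true ∷_) (elems m)))
    ≡⟨ cong +_ (ListSum.sum-++ (mapL h (mapL (false ∷_) (elems m))) _) ⟩
  + (sum (mapL h (mapL (false ∷_) (elems m))) ℕ.+ sum (mapL h (mapL (true ∷_) (elems m))))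
    ≡⟨ ℤ.pos-+ (sum (mapL h (mapL (false ∷_) (elems m)))) _ ⟩
  + sum (mapL h (mapL (false ∷_) (elems m))) + + sum (mapL h (mapL (true ∷_) (elems m)))
    ≡⟨ cong₂ (λ l l′ → + sum l + + sum l′) (sym (List.map-∘ (elems m))) (sym (List.map-∘ (elems m))) ⟩
  + (Σ[g∈Z2^ m ] (λ x → h (false ∷ x))) + + (Σ[g∈Z2^ m ] (λ x → h (true ∷ x)))
    ≡⟨ cong₂ _+_ (+-Σ m (λ x → h (false ∷ x))) (+-Σ m (λ x → h (true ∷ x))) ⟩
  ∑Z2^ (suc m) (+_ ∘ h) ∎
  where open ≡-Reasoning

+-prodFin : ∀ i (h : Fin i → ℕ) → + prodFin i h ≡ ∏ (+_ ∘ h)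
+-prodFin zero h = refl
+-prodFin (suc i) h = trans (ℤ.pos-* (h zero) _) (cong (+ h zero *_) (+-prodFin i (h ∘ suc)))

+-deck : ∀ {m} i (φ : Multiset m) s → + deck i φ s ≡ ∑Z2^ m (λ g → ∏ (λ j → + φ (g ⊕ s j)))
+-deck {m} i φ s = trans (+-Σ m _) (∑Z2^.∑-cong m (λ g → +-prodFin i _))

+-push : ∀ {n p} (θ : Z2^ n → Z2^ p) (φ : Multiset n) x → + push θ φ x ≡ ∑Z2^ n (λ z → δ (θ z) x * + φ z)
+-push {n} θ φ x = trans (+-Σ n _) (∑Z2^.∑-cong n (λ z → +-if (θ z ≟V x) (φ z)))
  where
  +-if : ∀ {P : Set} (P? : Dec P) k → + (if ⌊ P? ⌋ then k else 0) ≡ (if does P? then 1ℤ else 0ℤ) * + k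
  +-if (true because _) k = sym (ℤ.*-identityˡ (+ k))
  +-if (false because _) k = refl

fourier : ∀ {m} → Multiset m → (Z2^ m → Bool) → ℤ
fourier {m} φ c = ∑Z2^ m (λ x → + φ x * sign (c x))

fourier-cong : ∀ {m} (φ : Multiset m) {c c′ : Z2^ m → Bool} → c ≗ c′ → fourier φ c ≡ fourier φ c′
fourier-cong {m} φ c≗c′ = ∑Z2^.∑-cong m (λ x → cong (λ b → + φ x * sign b) (c≗c′ x))

fourierProduct : ∀ {m i} → Multiset m → (Fin i → Z2^ m → Bool) → ℤ
fourierProduct φ c = ∏ (λ j → fourier φ (c j))

fourier-translate : ∀ {m} (φ : Multiset m) {c} → IsAdditive c → ∀ g →
  ∑Z2^ m (λ y → + φ (g ⊕ y) * sign (c y)) ≡ sign (c g) * fourier φ c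
fourier-translate {m} φ {c} additive g = begin
  ∑Z2^ m (λ y → + φ (g ⊕ y) * sign (c y))
    ≡⟨ ∑Z2^.∑-cong m (λ y → cong (λ w → + φ (g ⊕ y) * sign (c w)) (sym (⊕-cancelˡ g y))) ⟩
  ∑Z2^ m (λ y → + φ (g ⊕ y) * sign (c (g ⊕ (g ⊕ y))))
    ≡⟨ ∑Z2^-translate m g (λ y → + φ y * sign (c (g ⊕ y))) ⟩
  ∑Z2^ m (λ y → + φ y * sign (c (g ⊕ y)))
    ≡⟨ ∑Z2^.∑-cong m (λ y → trans (cong (λ b → + φ y * sign b) (additive g y))
         (trans (cong (+ φ y *_) (sign-xor (c g) (c y))) (x∙yz≈y∙xz (+ φ y) (sign (c g)) (sign (c y))))) ⟩
  ∑Z2^ m (λ y → sign (c g) * (+ φ y * sign (c y)))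
    ≡⟨ ∑Z2^.∑-distribˡ-* m (sign (c g)) _ ⟩
  sign (c g) * fourier φ c ∎
  where open ≡-Reasoning

fourier-push : ∀ {n p} (θ : Z2^ n → Z2^ p) (φ : Multiset n) c → fourier (push θ φ) c ≡ fourier φ (c ∘ θ)
fourier-push {n} {p} θ φ c = begin
  ∑Z2^ p (λ x → + push θ φ x * sign (c x))
    ≡⟨ ∑Z2^.∑-cong p (λ x → cong (_* sign (c x)) (+-push θ φ x)) ⟩
  ∑Z2^ p (λ x → ∑Z2^ n (λ z → δ (θ z) x * + φ z) * sign (c x))
    ≡⟨ ∑Z2^.∑-cong p (λ x → trans (sym (∑Z2^.∑-distribʳ-* n (sign (c x)) _))
                                  (∑Z2^.∑-cong n (λ z → ℤ.*-assoc (δ (θ z) x) (+ φ z) (sign (c x))))) ⟩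
  ∑Z2^ p (λ x → ∑Z2^ n (λ z → δ (θ z) x * (+ φ z * sign (c x))))
    ≡⟨ ∑Z2^-fubini p (∑Z2^-isSum n) _ ⟩
  ∑Z2^ n (λ z → ∑Z2^ p (λ x → δ (θ z) x * (+ φ z * sign (c x))))
    ≡⟨ ∑Z2^.∑-cong n (λ z → ∑Z2^-δ p (θ z) (λ x → + φ z * sign (c x))) ⟩
  ∑Z2^ n (λ z → + φ z * sign (c (θ z))) ∎
  where open ≡-Reasoning

fourierProduct-push : ∀ {n p i} (θ : Z2^ n → Z2^ p) (φ : Multiset n) (c : Fin i → Z2^ p → Bool) →
  fourierProduct (push θ φ) c ≡ fourierProduct φ (λ j → c j ∘ θ)
fourierProduct-push θ φ c = ∏-cong (λ j → fourier-push θ φ (c j))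

transform : ∀ {m i} → (Vec (Z2^ m) i → ℤ) → (Fin i → Z2^ m → Bool) → ℤ
transform {m} {i} D c = ∑Tuples m i (λ t → D t * ∏ (λ j → sign (c j (lookup t j))))

deckOf : ∀ {m} i → Multiset m → Vec (Z2^ m) i → ℤ
deckOf i φ t = + deck i φ (lookup t)

transform-deck : ∀ {m} i (φ : Multiset m) (c : Fin i → Z2^ m → Bool) → (∀ j → IsAdditive (c j)) →
  transform (deckOf i φ) c ≡ characterSum m c * fourierProduct φ c
transform-deck {m} i φ c additive = begin
  ∑Tuples m i (λ t → + deck i φ (lookup t) * ∏ (λ j → sign (c j (lookup t j))))
    ≡⟨ ∑Tuples.∑-cong m i (λ t → cong (_* _) (+-deck i φ (lookup t))) ⟩
  ∑Tuples m i (λ t → ∑Z2^ m (λ g → ∏ (λ j → + φ (g ⊕ lookup t j))) * ∏ (λ j → sign (c j (lookup t j))))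
    ≡⟨ ∑Tuples.∑-cong m i (λ t → trans (sym (∑Z2^.∑-distribʳ-* m _ _)) (∑Z2^.∑-cong m (λ g →
         sym (∏-distrib-* (λ j → + φ (g ⊕ lookup t j)) (λ j → sign (c j (lookup t j))))))) ⟩
  ∑Tuples m i (λ t → ∑Z2^ m (λ g → ∏ (λ j → + φ (g ⊕ lookup t j) * sign (c j (lookup t j)))))
    ≡⟨ ∑Tuples-fubini m i (∑Z2^-isSum m) _ ⟩
  ∑Z2^ m (λ g → ∑Tuples m i (λ t → ∏ (λ j → + φ (g ⊕ lookup t j) * sign (c j (lookup t j)))))
    ≡⟨ ∑Z2^.∑-cong m (λ g → ∑Vec-∏ (∑Z2^-isSum m) i (λ j y → + φ (g ⊕ y) * sign (c j y))) ⟩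
  ∑Z2^ m (λ g → ∏ (λ j → ∑Z2^ m (λ y → + φ (g ⊕ y) * sign (c j y))))
    ≡⟨ ∑Z2^.∑-cong m (λ g → trans (∏-cong (λ j → fourier-translate φ (additive j) g))
                                   (∏-distrib-* (λ j → sign (c j g)) (λ j → fourier φ (c j)))) ⟩
  ∑Z2^ m (λ g → ∏ (λ j → sign (c j g)) * fourierProduct φ c)
    ≡⟨ ∑Z2^.∑-distribʳ-* m _ _ ⟩
  characterSum m c * fourierProduct φ c ∎
  where open ≡-Reasoning

transform-inversion : ∀ {m i} (D : Vec (Z2^ m) i → ℤ) (s : Vec (Z2^ m) i) →
  ∑Tuples m i (λ χ → transform D (dot ∘ lookup χ) * ∏ (λ j → sign (dot (lookup χ j) (lookup s j))))
    ≡ card^ m i * D s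
transform-inversion {m} {i} D s = begin
  ∑Tuples m i (λ χ → ∑Tuples m i (λ t → D t * ε χ t) * ε χ s)
    ≡⟨ ∑Tuples.∑-cong m i (λ χ → sym (∑Tuples.∑-distribʳ-* m i (ε χ s) _)) ⟩
  ∑Tuples m i (λ χ → ∑Tuples m i (λ t → D t * ε χ t * ε χ s))
    ≡⟨ ∑Tuples-fubini m i (∑Tuples-isSum m i) _ ⟩
  ∑Tuples m i (λ t → ∑Tuples m i (λ χ → D t * ε χ t * ε χ s))
    ≡⟨ ∑Tuples.∑-cong m i (λ t → trans
         (∑Tuples.∑-cong m i (λ χ → trans (xy∙z≈x∙zy (D t) (ε χ t) (ε χ s))
                                          (cong (D t *_) (sym (∏-distrib-* (σ χ s) (σ χ t))))))
         (∑Tuples.∑-distribˡ-* m i (D t) (λ χ → ∏ (λ j → σ χ s j * σ χ t j)))) ⟩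
  ∑Tuples m i (λ t → D t * ∑Tuples m i (λ χ → ∏ (λ j → σ χ s j * σ χ t j)))
    ≡⟨ ∑Tuples.∑-cong m i (λ t → cong (D t *_) (trans
         (∑Vec-∏ (∑Z2^-isSum m) i (λ j a → sign (dot a (lookup s j)) * sign (dot a (lookup t j))))
         (∏-cong (λ j → ∑Z2^-sign-dot m (lookup s j) (lookup t j))))) ⟩
  ∑Tuples m i (λ t → D t * ∏ (λ j → card m * Δ t j))
    ≡⟨ ∑Tuples.∑-cong m i (λ t → trans (cong (D t *_) (∏-distrib-* (λ _ → card m) (Δ t)))
                                       (x∙yz≈y∙zx (D t) (card^ m i) (∏ (Δ t)))) ⟩
  ∑Tuples m i (λ t → card^ m i * (∏ (Δ t) * D t))
    ≡⟨ ∑Tuples.∑-distribˡ-* m i (card^ m i) (λ t → ∏ (Δ t) * D t) ⟩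
  card^ m i * ∑Tuples m i (λ t → ∏ (Δ t) * D t)
    ≡⟨ cong (card^ m i *_) (∑Vec-δ (∑Z2^-isSum m) δ (∑Z2^-δ m) i s D) ⟩
  card^ m i * D s ∎
  where
  open ≡-Reasoning
  σ : Vec (Z2^ m) i → Vec (Z2^ m) i → Fin i → ℤ
  σ χ t j = sign (dot (lookup χ j) (lookup t j))
  ε : Vec (Z2^ m) i → Vec (Z2^ m) i → ℤ
  ε χ t = ∏ (σ χ t)
  Δ : Vec (Z2^ m) i → Fin i → ℤ
  Δ t j = δ (lookup s j) (lookup t j)

transform-injective : ∀ {m i} (D E : Vec (Z2^ m) i → ℤ) →
  (∀ χ → transform D (dot ∘ lookup χ) ≡ transform E (dot ∘ lookup χ)) → ∀ s → D s ≡ E s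
transform-injective {m} {i} D E same s =
  ℤ.*-cancelˡ-≡ (card^ m i) (D s) (E s) {{card^-nonZero m i}} (begin
  card^ m i * D s
    ≡⟨ sym (transform-inversion D s) ⟩
  ∑Tuples m i (λ χ → transform D (dot ∘ lookup χ) * ∏ (λ j → sign (dot (lookup χ j) (lookup s j))))
    ≡⟨ ∑Tuples.∑-cong m i (λ χ → cong (_* _) (same χ)) ⟩
  ∑Tuples m i (λ χ → transform E (dot ∘ lookup χ) * ∏ (λ j → sign (dot (lookup χ j) (lookup s j))))
    ≡⟨ transform-inversion E s ⟩
  card^ m i * E s ∎)
  where open ≡-Reasoning

ZeroSumAgreement : ∀ {m} → ℕ → Multiset m → Multiset m → Set
ZeroSumAgreement {m} k φ ψ = ∀ i → i ≤ k → (χ : Vec (Z2^ m) i) → vsum χ ≡ zeros m →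
  fourierProduct φ (dot ∘ lookup χ) ≡ fourierProduct ψ (dot ∘ lookup χ)

indist⇒fourierProduct≡ : ∀ {m k i} (φ ψ : Multiset m) → Indist k φ ψ → i ≤ k →
  (c : Fin i → Z2^ m → Bool) → (∀ j → IsAdditive (c j)) → Balanced c →
  fourierProduct φ c ≡ fourierProduct ψ c
indist⇒fourierProduct≡ {m} {k} {i} φ ψ indist i≤k c additive balanced =
  ℤ.*-cancelˡ-≡ (card m) _ _ {{card-nonZero m}} (begin
    card m * fourierProduct φ c
      ≡⟨ cong (_* fourierProduct φ c) (sym (characterSum-balanced c balanced)) ⟩
    characterSum m c * fourierProduct φ c
      ≡⟨ sym (transform-deck i φ c additive) ⟩
    transform (deckOf i φ) c
      ≡⟨ ∑Tuples.∑-cong m i (λ t →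
           cong (λ n → + n * ∏ (λ j → sign (c j (lookup t j)))) (indist i i≤k (lookup t))) ⟩
    transform (deckOf i ψ) c
      ≡⟨ transform-deck i ψ c additive ⟩
    characterSum m c * fourierProduct ψ c
      ≡⟨ cong (_* fourierProduct ψ c) (characterSum-balanced c balanced) ⟩
    card m * fourierProduct ψ c ∎)
  where open ≡-Reasoning

zeroSumAgreement⇒indist : ∀ {m k} (φ ψ : Multiset m) → ZeroSumAgreement k φ ψ → Indist k φ ψ
zeroSumAgreement⇒indist {m} {k} φ ψ agreement i i≤k s = ℤ.+-injective (begin
  + deck i φ s                    ≡⟨ +-deck-tabulate φ ⟩
  deckOf i φ (tabulate s)         ≡⟨ transform-injective (deckOf i φ) (deckOf i ψ) same-transform (tabulate s) ⟩
  deckOf i ψ (tabulate s)         ≡⟨ sym (+-deck-tabulate ψ) ⟩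
  + deck i ψ s                    ∎)
  where
  open ≡-Reasoning
  +-deck-tabulate : ∀ φ → + deck i φ s ≡ deckOf i φ (tabulate s)
  +-deck-tabulate φ = trans (+-deck i φ s) (trans
    (∑Z2^.∑-cong m (λ g → ∏-cong (λ j → cong (λ y → + φ (g ⊕ y)) (sym (lookup∘tabulate s j)))))
    (sym (+-deck i φ (lookup (tabulate s)))))
  same-transform : ∀ χ → transform (deckOf i φ) (dot ∘ lookup χ) ≡ transform (deckOf i ψ) (dot ∘ lookup χ)
  same-transform χ = trans (transform-deck i φ _ (dot-⊕ʳ ∘ lookup χ))
    (trans same-product (sym (transform-deck i ψ _ (dot-⊕ʳ ∘ lookup χ))))
    where
    same-product : characterSum m (dot ∘ lookup χ) * fourierProduct φ (dot ∘ lookup χ)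
                       ≡ characterSum m (dot ∘ lookup χ) * fourierProduct ψ (dot ∘ lookup χ)
    same-product with vsum χ ≟V zeros m
    ... | yes χ≡0 = cong (characterSum m (dot ∘ lookup χ) *_) (agreement i i≤k χ χ≡0)
    ... | no χ≢0 rewrite characterSum-dots χ χ≢0 = refl

zero-sum-balanced : ∀ {n m i} (χ : Vec (Z2^ m) i) → vsum χ ≡ zeros m → (θ : Z2^ n → Z2^ m) →
  Balanced (λ j → dot (lookup χ j) ∘ θ)
zero-sum-balanced χ χ≡0 θ z =
  trans (⨁-dot χ (θ z)) (trans (cong (λ v → dot v (θ z)) χ≡0) (dot-zerosˡ (θ z)))

push-preserves-indist : ∀ {n p k} (f g : Multiset n) → Indist k f g →
  (θ : Z2^ n → Z2^ p) → IsLinear θ → Indist k (push θ f) (push θ g)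
push-preserves-indist f g indist θ (θ-additive , _) =
  zeroSumAgreement⇒indist (push θ f) (push θ g) λ i i≤k χ χ≡0 → begin
    fourierProduct (push θ f) (dot ∘ lookup χ)
      ≡⟨ fourierProduct-push θ f (dot ∘ lookup χ) ⟩
    fourierProduct f (λ j → dot (lookup χ j) ∘ θ)
      ≡⟨ indist⇒fourierProduct≡ f g indist i≤k _
           (pulled-back-additive ∘ lookup χ) (zero-sum-balanced χ χ≡0 θ) ⟩
    fourierProduct g (λ j → dot (lookup χ j) ∘ θ)
      ≡⟨ sym (fourierProduct-push θ g (dot ∘ lookup χ)) ⟩
    fourierProduct (push θ g) (dot ∘ lookup χ) ∎
  where
  open ≡-Reasoning
  pulled-back-additive : ∀ a → IsAdditive (dot a ∘ θ)
  pulled-back-additive a x y = trans (cong (dot a) (θ-additive x y)) (dot-⊕ʳ a (θ x) (θ y))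

Exhaustible : Set → Set₁
Exhaustible A = ∀ {P R : A → Set} → (∀ x → P x ⊎ R x) → (∀ x → P x) ⊎ ∃ R

Bool-exhaustible : Exhaustible Bool
Bool-exhaustible decide with decide false | decide true
... | inj₂ r | _      = inj₂ (false , r)
... | inj₁ _ | inj₂ r = inj₂ (true , r)
... | inj₁ p | inj₁ q = inj₁ λ { false → p ; true → q }

Vec-exhaustible : ∀ {A} → Exhaustible A → ∀ n → Exhaustible (Vec A n)
Vec-exhaustible E zero decide with decide []
... | inj₁ p = inj₁ λ { [] → p }
... | inj₂ r = inj₂ ([] , r)
Vec-exhaustible E (suc n) decide with E (λ a → Vec-exhaustible E n (λ v → decide (a ∷ v)))
... | inj₁ p = inj₁ λ { (a ∷ v) → p a v }
... | inj₂ (a , v , r) = inj₂ (a ∷ v , r)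

≤-exhaustible : ∀ k {P R : ℕ → Set} → (∀ i → P i ⊎ R i) →
  (∀ i → i ≤ k → P i) ⊎ ∃[ i ] i ≤ k × R i
≤-exhaustible zero decide with decide 0
... | inj₁ p = inj₁ λ { zero z≤n → p }
... | inj₂ r = inj₂ (0 , z≤n , r)
≤-exhaustible (suc k) decide with decide 0 | ≤-exhaustible k (decide ∘ suc)
... | inj₂ r | _ = inj₂ (0 , z≤n , r)
... | inj₁ p | inj₁ q = inj₁ λ { zero _ → p ; (suc i) (s≤s i≤k) → q i i≤k }
... | inj₁ _ | inj₂ (i , i≤k , r) = inj₂ (suc i , s≤s i≤k , r)

agree-or-separate : ∀ {m i} (φ ψ : Multiset m) (χ : Vec (Z2^ m) i) →
  (vsum χ ≡ zeros m → fourierProduct φ (dot ∘ lookup χ) ≡ fourierProduct ψ (dot ∘ lookup χ)) ⊎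
  (vsum χ ≡ zeros m × fourierProduct φ (dot ∘ lookup χ) ≢ fourierProduct ψ (dot ∘ lookup χ))
agree-or-separate {m} φ ψ χ
  with vsum χ ≟V zeros m | fourierProduct φ (dot ∘ lookup χ) ℤ.≟ fourierProduct ψ (dot ∘ lookup χ)
... | no χ≢0 | _ = inj₁ λ χ≡0 → ⊥-elim (χ≢0 χ≡0)
... | yes _ | yes same = inj₁ λ _ → same
... | yes χ≡0 | no differ = inj₂ (χ≡0 , differ)

dist⇒zero-sum-witness : ∀ {m k} (φ ψ : Multiset m) → Dist k φ ψ →
  ∃[ i ] i ≤ k × Σ (Vec (Z2^ m) i) λ χ → vsum χ ≡ zeros m ×
    fourierProduct φ (dot ∘ lookup χ) ≢ fourierProduct ψ (dot ∘ lookup χ)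
dist⇒zero-sum-witness {m} {k} φ ψ dist
  with ≤-exhaustible k (λ i → Vec-exhaustible (Vec-exhaustible Bool-exhaustible m) i (agree-or-separate φ ψ))
... | inj₁ agreement = ⊥-elim (dist (zeroSumAgreement⇒indist φ ψ agreement))
... | inj₂ witness = witness

padRight-⊕ : ∀ {i k} (i≤k : i ≤ k) (u v : Z2^ i) →
  padRight i≤k false (u ⊕ v) ≡ padRight i≤k false u ⊕ padRight i≤k false v
padRight-⊕ z≤n [] [] = sym (zipWith-replicate _xor_ false false)
padRight-⊕ (s≤s i≤k) (a ∷ u) (b ∷ v) = cong ((a xor b) ∷_) (padRight-⊕ i≤k u v)

padRight-· : ∀ {i k} (i≤k : i ≤ k) c (u : Z2^ i) → padRight i≤k false (c · u) ≡ c · padRight i≤k false u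
padRight-· z≤n c [] = sym (trans (map-replicate (c ∧_) false _) (cong (replicate _) (∧-zeroʳ c)))
padRight-· (s≤s i≤k) c (a ∷ u) = cong ((c ∧ a) ∷_) (padRight-· i≤k c u)

truncate-⊕ : ∀ {i k} (i≤k : i ≤ k) (x y : Z2^ k) → truncate i≤k (x ⊕ y) ≡ truncate i≤k x ⊕ truncate i≤k y
truncate-⊕ z≤n x y = refl
truncate-⊕ (s≤s i≤k) (a ∷ x) (b ∷ y) = cong ((a xor b) ∷_) (truncate-⊕ i≤k x y)

dots : ∀ {m i} → Vec (Z2^ m) i → Z2^ m → Z2^ i
dots χ z = map (λ a → dot a z) χ

dots-⊕ : ∀ {m i} (χ : Vec (Z2^ m) i) x y → dots χ (x ⊕ y) ≡ dots χ x ⊕ dots χ y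
dots-⊕ [] x y = refl
dots-⊕ (a ∷ χ) x y = cong₂ _∷_ (dot-⊕ʳ a x y) (dots-⊕ χ x y)

dots-· : ∀ {m i} (χ : Vec (Z2^ m) i) c x → dots χ (c · x) ≡ c · dots χ x
dots-· [] c x = refl
dots-· (a ∷ χ) c x = cong₂ _∷_ (dot-·ʳ a c x) (dots-· χ c x)

coordinates : ∀ {n i k} → i ≤ k → Vec (Z2^ n) i → Z2^ n → Z2^ k
coordinates i≤k χ z = padRight i≤k false (dots χ z)

coordinates-linear : ∀ {n i k} (i≤k : i ≤ k) (χ : Vec (Z2^ n) i) → IsLinear (coordinates i≤k χ)
coordinates-linear i≤k χ =
  (λ x y → trans (cong (padRight i≤k false) (dots-⊕ χ x y)) (padRight-⊕ i≤k (dots χ x) (dots χ y))) ,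
  (λ c x → trans (cong (padRight i≤k false) (dots-· χ c x)) (padRight-· i≤k c (dots χ x)))

coordinateFamily : ∀ {i k} → i ≤ k → Fin (suc i) → Z2^ k → Bool
coordinateFamily i≤k zero y = ⨁ (lookup (truncate i≤k y))
coordinateFamily i≤k (suc j) y = lookup (truncate i≤k y) j

lookup-truncate-⊕ : ∀ {i k} (i≤k : i ≤ k) (x y : Z2^ k) j →
  lookup (truncate i≤k (x ⊕ y)) j ≡ lookup (truncate i≤k x) j xor lookup (truncate i≤k y) j
lookup-truncate-⊕ i≤k x y j =
  trans (cong (λ w → lookup w j) (truncate-⊕ i≤k x y)) (lookup-zipWith _xor_ j (truncate i≤k x) (truncate i≤k y))

coordinateFamily-additive : ∀ {i k} (i≤k : i ≤ k) j → IsAdditive (coordinateFamily i≤k j)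
coordinateFamily-additive i≤k zero x y =
  trans (⨁-cong (lookup-truncate-⊕ i≤k x y)) (⨁-distrib-xor (lookup (truncate i≤k x)) (lookup (truncate i≤k y)))
coordinateFamily-additive i≤k (suc j) x y = lookup-truncate-⊕ i≤k x y j

coordinateFamily-balanced : ∀ {i k} (i≤k : i ≤ k) → Balanced (coordinateFamily i≤k)
coordinateFamily-balanced i≤k y = xor-same (⨁ (lookup (truncate i≤k y)))

coordinateFamily-coordinates : ∀ {n i k} (i≤k : i ≤ k) (χ₀ : Z2^ n) (χ : Vec (Z2^ n) i) → χ₀ ≡ vsum χ →
  ∀ j z → coordinateFamily i≤k j (coordinates i≤k χ z) ≡ dot (lookup (χ₀ ∷ χ) j) z
coordinateFamily-coordinates i≤k χ₀ χ χ₀≡ zero z = begin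
  ⨁ (lookup (truncate i≤k (padRight i≤k false (dots χ z))))
    ≡⟨ cong (⨁ ∘ lookup) (truncate-padRight i≤k false (dots χ z)) ⟩
  ⨁ (lookup (dots χ z))
    ≡⟨ ⨁-cong (λ j → lookup-map j (λ a → dot a z) χ) ⟩
  ⨁ (λ j → dot (lookup χ j) z)
    ≡⟨ ⨁-dot χ z ⟩
  dot (vsum χ) z
    ≡⟨ cong (λ v → dot v z) (sym χ₀≡) ⟩
  dot χ₀ z ∎
  where open ≡-Reasoning
coordinateFamily-coordinates i≤k χ₀ χ χ₀≡ (suc j) z =
  trans (cong (λ w → lookup w j) (truncate-padRight i≤k false (dots χ z))) (lookup-map j (λ a → dot a z) χ)

coordinates-separate : ∀ {n i k} (f g : Multiset n) (i≤k : i ≤ k) (χ₀ : Z2^ n) (χ : Vec (Z2^ n) i) →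
  vsum (χ₀ ∷ χ) ≡ zeros n →
  fourierProduct f (dot ∘ lookup (χ₀ ∷ χ)) ≢ fourierProduct g (dot ∘ lookup (χ₀ ∷ χ)) →
  Dist (suc k) (push (coordinates i≤k χ) f) (push (coordinates i≤k χ) g)
coordinates-separate {n} {i} {k} f g i≤k χ₀ χ χ≡0 differ indist = differ (begin
  fourierProduct f (dot ∘ lookup (χ₀ ∷ χ))    ≡⟨ pull-back f ⟩
  fourierProduct (push θ f) η                 ≡⟨ indist⇒fourierProduct≡ (push θ f) (push θ g) indist (s≤s i≤k) η
                                                   (coordinateFamily-additive i≤k) (coordinateFamily-balanced i≤k) ⟩
  fourierProduct (push θ g) η                 ≡⟨ sym (pull-back g) ⟩
  fourierProduct g (dot ∘ lookup (χ₀ ∷ χ))    ∎)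
  where
  open ≡-Reasoning
  θ : Z2^ n → Z2^ k
  θ = coordinates i≤k χ
  η : Fin (suc i) → Z2^ k → Bool
  η = coordinateFamily i≤k
  pull-back : ∀ φ → fourierProduct φ (dot ∘ lookup (χ₀ ∷ χ)) ≡ fourierProduct (push θ φ) η
  pull-back φ = sym (trans (fourierProduct-push θ φ η)
    (∏-cong λ j → fourier-cong φ (coordinateFamily-coordinates i≤k χ₀ χ (⊕≡zeros⇒≡ χ≡0) j)))

separating-linear-map : ∀ {n} k (f g : Multiset n) → Dist k f g →
  Σ (Z2^ n → Z2^ (k ∸ 1)) (λ θ → IsLinear θ × Dist k (push θ f) (push θ g))
separating-linear-map k f g dist with dist⇒zero-sum-witness f g dist
... | zero , _ , [] , _ , differ = ⊥-elim (differ refl)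
... | suc i , s≤s i≤k , χ₀ ∷ χ , χ≡0 , differ =
  coordinates i≤k χ , coordinates-linear i≤k χ , coordinates-separate f g i≤k χ₀ χ χ≡0 differ

theorem3p4 : (n k : ℕ) → 1 ≤ n → 2 ≤ k → (f g : Multiset n) →
    (Indist k f g → (p : ℕ) → (θ : Z2^ n → Z2^ p) → IsLinear θ → Indist k (push θ f) (push θ g))
    × (Dist k f g → Σ (Z2^ n → Z2^ (k ∸ 1)) (λ θ → IsLinear θ × Dist k (push θ f) (push θ g)))
theorem3p4 n k _ _ f g = (λ indist p → push-preserves-indist f g indist) , separating-linear-map k f g
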